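{- For every $n\ge 1$, $$\max_{T^r}\ D^{\mathrm{pr}}_{\max}(T^r)=D^{\mathrm{pr}}_{\max}(S^{h}_n)=\binom{n}{2},$$ where the maximum is over all rooted trees $T^r$ with $n$ vertices and $S^h_n$ is the star tree on $n$ vertices rooted at its hub (the vertex of maximum degree).
   Context: A linear arrangement of a graph $G=(V,E)$ with $n=|V|$ is a bijection $\pi:V\to\{1,\dots,n\}$; the cost of $\pi$ is $\sum_{uv\in E}|\pi(u)-\pi(v)|$. Two edges $st,uv$ with $\pi(s)<\pi(t)$, $\pi(u)<\pi(v)$, $\pi(s)<\pi(u)$ cross if $\pi(s)<\pi(u)<\pi(t)<\pi(v)$; an arrangement is planar if no two edges cross. For a tree rooted at $r$, an arrangement is projective if it is planar and there is no edge $uv$ with $\min(\pi(u),\pi(v))<\pi(r)<\max(\pi(u),\pi(v))$. $D^{\mathrm{pr}}_{\max}(T^r)$ denotes the maximum cost over all projective arrangements of the rooted tree $T^r$. -}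

module Defs where

open import Data.Nat using (ℕ; zero; suc; _+_; _<_; _≤_; ∣_-_∣; _⊔_; _⊓_)
open import Data.Fin using (Fin; toℕ; zero; suc)
open import Data.Fin.Permutation using (Permutation′; _⟨$⟩ʳ_)
open import Data.Product using (_×_; _,_; Σ; ∃)
open import Data.Sum using (_⊎_)
open import Data.List using (List; []; _∷_; _++_; [_]; length; map)
open import Data.Nat.ListAction using (sum)
open import Data.List.Membership.Propositional using (_∈_)
open import Data.List.Relation.Unary.All using (All)
open import Data.List.Relation.Unary.Unique.Propositional using (Unique)
open import Data.List.Relation.Unary.Linked using (Linked)
open import Relation.Binary.Construct.Closure.ReflexiveTransitive using (Star)
open import Relation.Nullary using (¬_)

-- A simple graph on the vertex set Fin n, given by its list of edges.
-- Each edge {u,v} is stored once, as the pair (u , v) with u < v.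
Graph : ℕ → Set
Graph n = List (Fin n × Fin n)

SimpleGraph : ∀ {n} → Graph n → Set
SimpleGraph E = All (λ e → toℕ (Data.Product.proj₁ e) < toℕ (Data.Product.proj₂ e)) E × Unique E
  where import Data.Product

Adj : ∀ {n} → Graph n → Fin n → Fin n → Set
Adj E u v = ((u , v) ∈ E) ⊎ ((v , u) ∈ E)

Connected : ∀ {n} → Graph n → Set
Connected E = ∀ u v → Star (Adj E) u v

HasCycle : ∀ {n} → Graph n → Set
HasCycle {n} E = Σ (Fin n) λ v → Σ (List (Fin n)) λ ws →
  (2 ≤ length ws) × Unique (v ∷ ws) × Linked (Adj E) (v ∷ ws ++ [ v ])

IsTree : ∀ {n} → Graph n → Set
IsTree E = SimpleGraph E × Connected E × ¬ HasCycle E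

-- Linear arrangements: bijections V → {0,…,n-1} (positions shifted by one
-- with respect to the paper; costs and crossings are unaffected).
Arrangement : ℕ → Set
Arrangement n = Permutation′ n

pos : ∀ {n} → Arrangement n → Fin n → ℕ
pos π u = toℕ (π ⟨$⟩ʳ u)

cost : ∀ {n} → Arrangement n → Graph n → ℕ
cost π E = sum (map (λ e → ∣ pos π (proj₁ e) - pos π (proj₂ e) ∣) E)
  where open import Data.Product using (proj₁; proj₂)

lo hi : ∀ {n} → Arrangement n → Fin n × Fin n → ℕ
lo π (u , v) = pos π u ⊓ pos π v
hi π (u , v) = pos π u ⊔ pos π v

Cross : ∀ {n} → Arrangement n → Fin n × Fin n → Fin n × Fin n → Set
Cross π e f =
  (lo π e < lo π f × lo π f < hi π e × hi π e < hi π f) ⊎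
  (lo π f < lo π e × lo π e < hi π f × hi π f < hi π e)

Planar : ∀ {n} → Graph n → Arrangement n → Set
Planar E π = ∀ e f → e ∈ E → f ∈ E → ¬ Cross π e f

RootUncovered : ∀ {n} → Graph n → Fin n → Arrangement n → Set
RootUncovered E r π = ∀ e → e ∈ E → ¬ (lo π e < pos π r × pos π r < hi π e)

Projective : ∀ {n} → Graph n → Fin n → Arrangement n → Set
Projective E r π = Planar E π × RootUncovered E r π

IsDprMax : ∀ {n} → Graph n → Fin n → ℕ → Set
IsDprMax {n} E r k =
  (Σ (Arrangement n) λ π → Projective E r π × cost π E Relation.Binary.PropositionalEquality.≡ k)
  × (∀ (π : Arrangement n) → Projective E r π → cost π E ≤ k)
  where import Relation.Binary.PropositionalEquality

star : (m : ℕ) → Graph (suc m)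
star m = Data.List.map (λ i → (zero , suc i)) (Data.List.allFin m)
  where import Data.List

hub : (m : ℕ) → Fin (suc m)
hub m = zero

-- Every star edge contains the hub, so no two star edges cross and none covers the
-- hub: every arrangement of the star is projective, and with the hub first its cost
-- is 1 + 2 + ⋯ + m = C(m+1, 2).
--
-- Conversely, a projective arrangement is planar, and a planar arrangement of a
-- forest costs at most T(m) = 1 + ⋯ + m.  This follows by induction on the width d
-- of a window [l, l + d] holding a noncrossing forest, strengthened by: a cost above
-- T(d) − d forces a path from position l to position l + d inside the window.  A
-- window is split at the farthest right end x < l + d of an edge leaving l; every
-- other edge then lies in [l, x] or in [x, l + d], except possibly the single edge
-- spanning the window.  As T(a + b) = T(a) + T(b) + ab, the halves together cost at
-- most T(d); the spanning edge adds d, which fits because one half must have slack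
-- (two spanning paths plus the spanning edge would close a cycle).

module Submission where

open import Defs
open import Data.Nat using (ℕ; suc; _≤_)
open import Data.Nat.Combinatorics using (_C_)
open import Data.Fin using (Fin)
open import Data.Product using (_×_)

open import Data.Nat using (zero; _+_; _*_; _<_; _⊓_; _⊔_; ∣_-_∣; z≤n; s≤s; z<s; _≟_; _<?_; _≤?_)
open import Data.Nat.Properties
open import Algebra.Properties.CommutativeSemigroup +-commutativeSemigroup
  using () renaming (x∙yz≈y∙xz to x+[y+z]≡y+[x+z])
open import Data.Nat.Combinatorics using (nCk+nC[k+1]≡[n+1]C[k+1]; nC1≡n)
open import Data.Nat.Induction using (<-wellFounded)
open import Data.Nat.ListAction using (sum)
open import Data.Nat.Tactic.RingSolver using (solve-∀)
open import Data.Fin as Fin using (toℕ)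
open import Data.Fin.Properties using (toℕ-injective; toℕ<n)
open import Data.Fin.Permutation using (_⟨$⟩ʳ_; _⟨$⟩ˡ_; inverseˡ)
import Data.Fin.Permutation as Permutation
open import Data.Product using (Σ; ∃; ∃₂; _,_; proj₁; proj₂)
open import Function using (_∘_; id)
open import Data.Sum using (_⊎_; inj₁; inj₂; swap) renaming (map to ⊎-map)
open import Data.Empty using (⊥; ⊥-elim)
open import Data.List using (List; []; _∷_; _++_; [_]; length; map; filter; allFin; tabulate)
open import Data.List.Properties using (++-assoc; length-++; map-∘; map-tabulate)
open import Data.List.Membership.Propositional using (_∈_; _∉_)
open import Data.List.Membership.Propositional.Properties using (∈-filter⁻; ∈-filter⁺; ∈-map⁻; ∈-map⁺; ∈-allFin)
open import Data.List.Relation.Unary.Any using (here; there)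
open import Data.List.Relation.Unary.All as All using (All; []; _∷_)
import Data.List.Relation.Unary.All.Properties as All
open import Data.List.Relation.Unary.AllPairs using ([]; _∷_)
open import Data.List.Relation.Unary.Unique.Propositional using (Unique)
import Data.List.Relation.Unary.Unique.Propositional.Properties as Unique
open import Data.List.Relation.Unary.Linked as Linked using (Linked; []; [-]; _∷_)
open import Data.List.Relation.Binary.Subset.Propositional using (_⊆_)
open import Data.List.Relation.Binary.Disjoint.Propositional using (Disjoint)
open import Data.List.Extrema.Nat using (max; ⊥≤max; xs≤max; max<v⁺; argmax-sel)
open import Relation.Binary.PropositionalEquality hiding ([_])
open import Relation.Binary.Construct.Closure.ReflexiveTransitive using (Star; ε; _◅_; _◅◅_)
open import Relation.Nullary using (¬_; yes; no; _×-dec_)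
open import Relation.Unary using (Decidable)
open import Relation.Unary.Properties using (∁?)
open import Induction.WellFounded using (Acc; acc)

Linked-join : ∀ {A : Set} {R : A → A → Set} xs {x : A} {ys} →
              Linked R (xs ++ [ x ]) → Linked R (x ∷ ys) → Linked R (xs ++ x ∷ ys)
Linked-join []           _            Rxys = Rxys
Linked-join (_ ∷ [])     (Rxy ∷ [-])  Rxys = Rxy ∷ Rxys
Linked-join (_ ∷ y ∷ xs) (Rxy ∷ Rxs)  Rxys = Rxy ∷ Linked-join (y ∷ xs) Rxs Rxys

Unique-∷ʳ⁻ : ∀ {A : Set} xs {x : A} → Unique (xs ++ [ x ]) → Unique xs × x ∉ xs
Unique-∷ʳ⁻ []       _          = [] , λ ()
Unique-∷ʳ⁻ (y ∷ xs) (y∉ ∷ uxs) with Unique-∷ʳ⁻ xs uxs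
... | uxs′ , x∉xs = All.++⁻ˡ xs y∉ ∷ uxs′ , λ
  { (here refl) → All.head (All.++⁻ʳ xs y∉) refl
  ; (there x∈xs) → x∉xs x∈xs }

Unique-subsingleton : ∀ {A : Set} {xs : List A} → Unique xs →
                      (∀ {x y} → x ∈ xs → y ∈ xs → x ≡ y) → xs ≡ [] ⊎ ∃ λ x → xs ≡ [ x ]
Unique-subsingleton {xs = []}         _                   _   = inj₁ refl
Unique-subsingleton {xs = x ∷ []}     _                   _   = inj₂ (x , refl)
Unique-subsingleton {xs = x ∷ y ∷ _} ((x≢y ∷ _) ∷ _) all≡ =
  ⊥-elim (x≢y (all≡ (here refl) (there (here refl))))

sum-map-partition : ∀ {A : Set} {P : A → Set} (f : A → ℕ) (P? : Decidable P) xs →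
                    sum (map f xs) ≡ sum (map f (filter P? xs)) + sum (map f (filter (∁? P?) xs))
sum-map-partition f P? []       = refl
sum-map-partition f P? (x ∷ xs) with P? x
... | yes _ = trans (cong (f x +_) (sum-map-partition f P? xs)) (sym (+-assoc (f x) _ _))
... | no  _ = trans (cong (f x +_) (sum-map-partition f P? xs)) (x+[y+z]≡y+[x+z] (f x) (sum (map f (filter P? xs))) _)

<⇒+suc : ∀ {m n} → m < n → ∃ λ k → m + suc k ≡ n
<⇒+suc {m} m<n with m≤n⇒∃[o]m+o≡n m<n
... | k , m+1+k≡n = k , trans (+-suc m k) m+1+k≡n

offsets-+ : ∀ l a {x b h} → l + a ≡ x → x + b ≡ h → l + (a + b) ≡ h
offsets-+ l a {b = b} refl refl = sym (+-assoc l a b)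

triangular : ℕ → ℕ
triangular zero    = 0
triangular (suc m) = suc m + triangular m

triangular≡C2 : ∀ m → triangular m ≡ suc m C 2
triangular≡C2 zero    = refl
triangular≡C2 (suc m) = begin
  suc m + triangular m     ≡⟨ cong₂ _+_ (sym (nC1≡n (suc m))) (triangular≡C2 m) ⟩
  suc m C 1 + suc m C 2    ≡⟨ nCk+nC[k+1]≡[n+1]C[k+1] (suc m) 1 ⟩
  suc (suc m) C 2          ∎
  where open ≡-Reasoning

triangular-+ : ∀ a b → triangular (a + b) ≡ triangular a + triangular b + a * b
triangular-+ zero    b = sym (+-identityʳ (triangular b))
triangular-+ (suc a) b = begin
  suc (a + b) + triangular (a + b)                  ≡⟨ cong (suc (a + b) +_) (triangular-+ a b) ⟩
  suc (a + b) + (triangular a + triangular b + a * b) ≡⟨ regroup a b (triangular a) (triangular b) (a * b) ⟩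
  suc a + triangular a + triangular b + (b + a * b) ∎
  where
  open ≡-Reasoning
  regroup : ∀ a b s t p → suc (a + b) + (s + t + p) ≡ suc a + s + t + (b + p)
  regroup = solve-∀

triangular-superadditive : ∀ {A B} a b → A ≤ triangular a → B ≤ triangular b → A + B ≤ triangular (a + b)
triangular-superadditive {A} {B} a b A≤ B≤ = begin
  A + B                                     ≤⟨ +-mono-≤ A≤ B≤ ⟩
  triangular a + triangular b               ≤⟨ m≤m+n _ (a * b) ⟩
  triangular a + triangular b + a * b       ≡⟨ triangular-+ a b ⟨
  triangular (a + b)                        ∎
  where open ≤-Reasoning

triangular-slack : ∀ {A B} x y → A + suc x ≤ triangular (suc x) → B ≤ triangular y →
                   A + B + (suc x + y) ≤ triangular (suc x + y)
triangular-slack {A} {B} x y slack B≤ = begin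
  A + B + (suc x + y)                             ≡⟨ regroup A B (suc x) y ⟩
  A + suc x + B + y                               ≤⟨ +-monoˡ-≤ y (+-mono-≤ slack B≤) ⟩
  triangular (suc x) + triangular y + y           ≤⟨ +-monoʳ-≤ _ (m≤n*m y (suc x)) ⟩
  triangular (suc x) + triangular y + suc x * y   ≡⟨ triangular-+ (suc x) y ⟨
  triangular (suc x + y)                          ∎
  where
  open ≤-Reasoning
  regroup : ∀ A B x y → A + B + (x + y) ≡ A + x + B + y
  regroup = solve-∀

triangular-glue : ∀ {A B} a b → A ≤ triangular (suc a) → B ≤ triangular (suc b) →
                  A + suc a ≤ triangular (suc a) ⊎ B + suc b ≤ triangular (suc b) →
                  A + B + (suc a + suc b) ≤ triangular (suc a + suc b)
triangular-glue a b _ B≤ (inj₁ slackˡ) = triangular-slack a (suc b) slackˡ B≤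
triangular-glue {A} {B} a b A≤ _ (inj₂ slackʳ) =
  subst₂ _≤_ (swap-sides B A (suc b) (suc a)) (cong triangular (+-comm (suc b) (suc a)))
         (triangular-slack b (suc a) slackʳ A≤)
  where
  swap-sides : ∀ B A y x → B + A + (y + x) ≡ A + B + (x + y)
  swap-sides = solve-∀

Adj-mono : ∀ {n} {T S : Graph n} → T ⊆ S → ∀ {u v} → Adj T u v → Adj S u v
Adj-mono T⊆S = ⊎-map T⊆S T⊆S

HasCycle-mono : ∀ {n} {T S : Graph n} → T ⊆ S → HasCycle T → HasCycle S
HasCycle-mono T⊆S (v , ws , long , unique , linked) = v , ws , long , unique , Linked.map (Adj-mono T⊆S) linked

module _ {n : ℕ} (π : Arrangement n) where

  pos-injective : ∀ {u v} → pos π u ≡ pos π v → u ≡ v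
  pos-injective {u} {v} eq = begin
    u                    ≡⟨ inverseˡ π ⟨
    π ⟨$⟩ˡ (π ⟨$⟩ʳ u)    ≡⟨ cong (π ⟨$⟩ˡ_) (toℕ-injective eq) ⟩
    π ⟨$⟩ˡ (π ⟨$⟩ʳ v)    ≡⟨ inverseˡ π ⟩
    v                    ∎
    where open ≡-Reasoning

  width : Fin n × Fin n → ℕ
  width e = ∣ pos π (proj₁ e) - pos π (proj₂ e) ∣

  Oriented : Fin n × Fin n → Set
  Oriented (u , v) = toℕ u < toℕ v

  lo<hi : ∀ {e} → Oriented e → lo π e < hi π e
  lo<hi {u , v} u<v with ≤-total (pos π u) (pos π v)
  ... | inj₁ u≤v rewrite m≤n⇒m⊓n≡m u≤v | m≤n⇒m⊔n≡n u≤v = ≤∧≢⇒< u≤v (u≢v ∘ pos-injective)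
    where u≢v : u ≢ v
          u≢v u≡v = <-irrefl (cong toℕ u≡v) u<v
  ... | inj₂ v≤u rewrite m≥n⇒m⊓n≡n v≤u | m≥n⇒m⊔n≡m v≤u = ≤∧≢⇒< v≤u (v≢u ∘ pos-injective)
    where v≢u : v ≢ u
          v≢u v≡u = <-irrefl (cong toℕ (sym v≡u)) u<v

  Spans : ℕ → ℕ → Fin n × Fin n → Set
  Spans l h e = lo π e ≡ l × hi π e ≡ h

  spans? : ∀ l h → Decidable (Spans l h)
  spans? l h e = (lo π e ≟ l) ×-dec (hi π e ≟ h)

  Spans-ends : ∀ {l h u v} → Spans l h (u , v) → (pos π u ≡ l × pos π v ≡ h) ⊎ (pos π u ≡ h × pos π v ≡ l)
  Spans-ends {u = u} {v} (lo≡l , hi≡h) with ≤-total (pos π u) (pos π v)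
  ... | inj₁ u≤v = inj₁ (trans (sym (m≤n⇒m⊓n≡m u≤v)) lo≡l , trans (sym (m≤n⇒m⊔n≡n u≤v)) hi≡h)
  ... | inj₂ v≤u = inj₂ (trans (sym (m≥n⇒m⊔n≡m v≤u)) hi≡h , trans (sym (m≥n⇒m⊓n≡n v≤u)) lo≡l)

  Spans-width : ∀ {l d h e} → l + d ≡ h → Spans l h e → width e ≡ d
  Spans-width {l} {d} {e = u , v} refl spans with Spans-ends spans
  ... | inj₁ (ul , vh) rewrite ul | vh = trans (m≤n⇒∣m-n∣≡n∸m (m≤m+n l d)) (m+n∸m≡n l d)
  ... | inj₂ (uh , vl) rewrite uh | vl = trans (m≤n⇒∣n-m∣≡n∸m (m≤m+n l d)) (m+n∸m≡n l d)

  Spans-unique : ∀ {l h e f} → Oriented e → Oriented f → Spans l h e → Spans l h f → e ≡ f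
  Spans-unique {e = u , v} {u′ , v′} u<v u′<v′ spansᵉ spansᶠ with Spans-ends spansᵉ | Spans-ends spansᶠ
  ... | inj₁ (ul , vh) | inj₁ (u′l , v′h) =
    cong₂ _,_ (pos-injective (trans ul (sym u′l))) (pos-injective (trans vh (sym v′h)))
  ... | inj₂ (uh , vl) | inj₂ (u′h , v′l) =
    cong₂ _,_ (pos-injective (trans uh (sym u′h))) (pos-injective (trans vl (sym v′l)))
  ... | inj₁ (ul , vh) | inj₂ (u′h , v′l)
    with pos-injective (trans ul (sym v′l)) | pos-injective (trans vh (sym u′h))
  ...   | refl | refl = ⊥-elim (<-asym u<v u′<v′)
  Spans-unique u<v u′<v′ _ _ | inj₂ (uh , vl) | inj₁ (u′l , v′h)
    with pos-injective (trans uh (sym v′h)) | pos-injective (trans vl (sym u′l))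
  ...   | refl | refl = ⊥-elim (<-asym u<v u′<v′)

  Spans-adj : ∀ {S l h e} → e ∈ S → Spans l h e → ∃₂ λ s t → pos π s ≡ l × pos π t ≡ h × Adj S s t
  Spans-adj {e = u , v} e∈S spans with Spans-ends spans
  ... | inj₁ (ul , vh) = u , v , ul , vh , inj₁ e∈S
  ... | inj₂ (uh , vl) = v , u , vl , uh , inj₂ e∈S

  Between : ℕ → ℕ → Fin n → Set
  Between l h v = l ≤ pos π v × pos π v ≤ h

  record PathIn (S : Graph n) (l h : ℕ) : Set where
    constructor path
    field
      start end : Fin n
      inner     : List (Fin n)
      start-at  : pos π start ≡ l
      end-at    : pos π end ≡ h
      linked    : Linked (Adj S) (start ∷ inner ++ [ end ])
      unique    : Unique (start ∷ inner ++ [ end ])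
      between   : All (Between l h) (start ∷ inner ++ [ end ])

  PathIn-mono : ∀ {T S l h} → T ⊆ S → PathIn T l h → PathIn S l h
  PathIn-mono T⊆S (path s t vs s-at t-at linked unique between) =
    path s t vs s-at t-at (Linked.map (Adj-mono T⊆S) linked) unique between

  Spans-path : ∀ {S l h e} → e ∈ S → Spans l h e → l < h → PathIn S l h
  Spans-path e∈S spans l<h with Spans-adj e∈S spans
  ... | s , t , refl , refl , adj = path s t [] refl refl (adj ∷ [-]) (s≢t ∷ [] ∷ []) ((≤-refl , <⇒≤ l<h) ∷ (<⇒≤ l<h , ≤-refl) ∷ [])
    where s≢t : All (s ≢_) [ t ]
          s≢t = (λ s≡t → <-irrefl (cong (pos π) s≡t) l<h) ∷ []

  Detour : Graph n → ℕ → ℕ → Set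
  Detour S l h = Σ (PathIn S l h) λ p → 1 ≤ length (PathIn.inner p)

  join : ∀ {S l x h} → PathIn S l x → PathIn S x h → Detour S l h
  join {S} (path s t ps refl refl L U W) (path t′ u qs t′-at refl L′ U′ W′) with pos-injective t′-at
  ... | refl = path s u (ps ++ t ∷ qs) refl refl linked unique between , nonempty
    where
    reassoc : (ps ++ t ∷ qs) ++ [ u ] ≡ ps ++ t ∷ qs ++ [ u ]
    reassoc = ++-assoc ps (t ∷ qs) [ u ]
    linked : Linked (Adj S) (s ∷ (ps ++ t ∷ qs) ++ [ u ])
    linked = subst (λ vs → Linked (Adj S) (s ∷ vs)) (sym reassoc) (Linked-join (s ∷ ps) L L′)
    W₁ : All (Between (pos π s) (pos π t)) (s ∷ ps)
    W₁ = All.++⁻ˡ (s ∷ ps) W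
    first : Unique (s ∷ ps) × t ∉ s ∷ ps
    first = Unique-∷ʳ⁻ (s ∷ ps) U
    before-t : All (λ v → pos π v < pos π t) (s ∷ ps)
    before-t = All.tabulate λ {v} v∈ →
      ≤∧≢⇒< (proj₂ (All.lookup W₁ v∈)) (λ eq → proj₂ first (subst (_∈ s ∷ ps) (pos-injective eq) v∈))
    disjoint : Disjoint (s ∷ ps) (t ∷ qs ++ [ u ])
    disjoint (v∈₁ , v∈₂) = <⇒≱ (All.lookup before-t v∈₁) (proj₁ (All.lookup W′ v∈₂))
    unique : Unique (s ∷ (ps ++ t ∷ qs) ++ [ u ])
    unique = subst (λ vs → Unique (s ∷ vs)) (sym reassoc) (Unique.++⁺ (proj₁ first) U′ disjoint)
    s≤t : pos π s ≤ pos π t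
    s≤t = proj₂ (All.head W)
    t≤u : pos π t ≤ pos π u
    t≤u = proj₂ (All.head W′)
    between : All (Between (pos π s) (pos π u)) (s ∷ (ps ++ t ∷ qs) ++ [ u ])
    between = subst (λ vs → All (Between (pos π s) (pos π u)) (s ∷ vs)) (sym reassoc)
      (All.++⁺ (All.map (λ (l≤ , ≤t) → l≤ , ≤-trans ≤t t≤u) W₁) (All.map (λ (t≤ , ≤u) → ≤-trans s≤t t≤ , ≤u) W′))
    nonempty : 1 ≤ length (ps ++ t ∷ qs)
    nonempty = subst (1 ≤_) (sym (length-++ ps)) (≤-trans (s≤s z≤n) (m≤n+m (suc (length qs)) (length ps)))

  Spans-cycle : ∀ {S l h e} → Detour S l h → e ∈ S → Spans l h e → HasCycle S
  Spans-cycle {S} (path s t ps refl refl L U _ , nonempty) e∈S spans with Spans-adj e∈S spans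
  ... | s′ , t′ , s′-at , t′-at , adj with pos-injective s′-at | pos-injective t′-at
  ... | refl | refl = s , ps ++ [ t ] , long , U , linked
    where
    long : 2 ≤ length (ps ++ [ t ])
    long = subst (2 ≤_) (sym (length-++ ps)) (+-monoˡ-≤ 1 nonempty)
    linked : Linked (Adj S) (s ∷ (ps ++ [ t ]) ++ [ s ])
    linked = subst (λ vs → Linked (Adj S) (s ∷ vs)) (sym (++-assoc ps [ t ] [ s ]))
                   (Linked-join (s ∷ ps) L (swap adj ∷ [-]))

  record NoncrossingForest (l h : ℕ) (S : Graph n) : Set where
    field
      simple  : SimpleGraph S
      planar  : Planar S π
      acyclic : ¬ HasCycle S
      inside  : ∀ {e} → e ∈ S → l ≤ lo π e × hi π e ≤ h

    oriented : ∀ {e} → e ∈ S → Oriented e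
    oriented {_ , _} = All.lookup (proj₁ simple)

  restrict : ∀ {l h l′ h′ S} {P : Fin n × Fin n → Set} (P? : Decidable P) → NoncrossingForest l h S →
             (∀ {e} → e ∈ S → P e → l′ ≤ lo π e × hi π e ≤ h′) → NoncrossingForest l′ h′ (filter P? S)
  restrict {S = S} P? F inside′ = record
    { simple  = All.tabulate (All.lookup (proj₁ simple) ∘ sub) , Unique.filter⁺ P? (proj₂ simple)
    ; planar  = λ e f e∈ f∈ → planar e f (sub e∈) (sub f∈)
    ; acyclic = acyclic ∘ HasCycle-mono sub
    ; inside  = λ e∈ → let e∈S , Pe = ∈-filter⁻ P? {xs = S} e∈ in inside′ e∈S Pe
    }
    where
    open NoncrossingForest F
    sub : filter P? S ⊆ S
    sub = proj₁ ∘ ∈-filter⁻ P? {xs = S}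

  split : ∀ {l h S} → NoncrossingForest l h S → suc l < h →
          ∃ λ x → l < x × x < h × (∀ {e} → e ∈ S → Spans l h e ⊎ hi π e ≤ x ⊎ x ≤ lo π e)
  split {l} {h} {S} F l+1<h = x , ⊥≤max (suc l) ys , max<v⁺ l+1<h ys<h , classify
    where
    open NoncrossingForest F
    fromL? : Decidable (λ e → lo π e ≡ l × hi π e < h)
    fromL? e = (lo π e ≟ l) ×-dec (hi π e <? h)
    ys : List ℕ
    ys = map (hi π) (filter fromL? S)
    x : ℕ
    x = max (suc l) ys
    ys<h : All (_< h) ys
    ys<h = All.map⁺ (All.tabulate (proj₂ ∘ proj₂ ∘ ∈-filter⁻ fromL? {xs = S}))
    inner-edge-cannot-straddle : ∀ {e} → e ∈ S → l < lo π e → lo π e < x → x < hi π e → ⊥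
    inner-edge-cannot-straddle {e} e∈S l<lo lo<x x<hi with argmax-sel id (suc l) ys
    ... | inj₁ x≡l+1 = <⇒≱ l<lo (≤-pred (subst (lo π e <_) x≡l+1 lo<x))
    ... | inj₂ x∈ys with ∈-map⁻ (hi π) x∈ys
    ...   | f , f∈ , x≡hi with ∈-filter⁻ fromL? {xs = S} f∈
    ...     | f∈S , lo≡l , _ = planar f e f∈S e∈S
      (inj₁ (subst (_< lo π e) (sym lo≡l) l<lo , subst (lo π e <_) x≡hi lo<x , subst (_< hi π e) x≡hi x<hi))
    straddling-spans : ∀ {e} → e ∈ S → lo π e < x → x < hi π e → Spans l h e
    straddling-spans {e} e∈S lo<x x<hi with lo π e ≟ l | hi π e ≟ h
    ... | yes lo≡l | yes hi≡h = lo≡l , hi≡h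
    ... | yes lo≡l | no hi≢h = ⊥-elim (<⇒≱ x<hi (All.lookup (xs≤max (suc l) ys)
            (∈-map⁺ (hi π) (∈-filter⁺ fromL? e∈S (lo≡l , ≤∧≢⇒< (proj₂ (inside e∈S)) hi≢h)))))
    ... | no lo≢l | _ = ⊥-elim (inner-edge-cannot-straddle e∈S (≤∧≢⇒< (proj₁ (inside e∈S)) (lo≢l ∘ sym)) lo<x x<hi)
    classify : ∀ {e} → e ∈ S → Spans l h e ⊎ hi π e ≤ x ⊎ x ≤ lo π e
    classify {e} e∈S with hi π e ≤? x | x ≤? lo π e
    ... | yes hi≤x | _        = inj₂ (inj₁ hi≤x)
    ... | no _     | yes x≤lo = inj₂ (inj₂ x≤lo)
    ... | no hi≰x  | no x≰lo  = inj₁ (straddling-spans e∈S (≰⇒> x≰lo) (≰⇒> hi≰x))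

  at-most-one-spanning : ∀ {l h S} → NoncrossingForest l h S → (∀ {e} → e ∈ S → Spans l h e) →
                     S ≡ [] ⊎ ∃ λ e → S ≡ [ e ]
  at-most-one-spanning F spans = Unique-subsingleton (proj₂ simple) λ e∈ f∈ →
    Spans-unique (oriented e∈) (oriented f∈) (spans e∈) (spans f∈)
    where open NoncrossingForest F

  unit-window-spans : ∀ {l h S} → l + 1 ≡ h → NoncrossingForest l h S → ∀ {e} → e ∈ S → Spans l h e
  unit-window-spans {l} {h} l+1≡h F {e} e∈ =
    ≤-antisym (≤-pred (subst (lo π e <_) h≡1+l lo<h)) l≤lo ,
    ≤-antisym hi≤h (subst (_≤ hi π e) (sym h≡1+l) (≤-<-trans l≤lo lo<hi′))
    where
    open NoncrossingForest F
    h≡1+l : h ≡ suc l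
    h≡1+l = trans (sym l+1≡h) (+-comm l 1)
    l≤lo : l ≤ lo π e
    l≤lo = proj₁ (inside e∈)
    hi≤h : hi π e ≤ h
    hi≤h = proj₂ (inside e∈)
    lo<hi′ : lo π e < hi π e
    lo<hi′ = lo<hi (oriented e∈)
    lo<h : lo π e < h
    lo<h = <-≤-trans lo<hi′ hi≤h

  CostBound : ℕ → ℕ → ℕ → Graph n → Set
  CostBound d l h S = cost π S ≤ triangular d × (triangular d < cost π S + d → PathIn S l h)

  module Glue {a b l x h S} (l+a≡x : l + suc a ≡ x) (x+b≡h : x + suc b ≡ h) (F : NoncrossingForest l h S)
              (classify : ∀ {e} → e ∈ S → Spans l h e ⊎ hi π e ≤ x ⊎ x ≤ lo π e)
              (boundˡ : ∀ {T} → NoncrossingForest l x T → CostBound (suc a) l x T)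
              (boundʳ : ∀ {T} → NoncrossingForest x h T → CostBound (suc b) x h T) where
    open NoncrossingForest F

    d : ℕ
    d = suc a + suc b

    l+d≡h : l + d ≡ h
    l+d≡h = offsets-+ l (suc a) l+a≡x x+b≡h

    Fs Ns Ls Rs : Graph n
    Fs = filter (spans? l h) S
    Ns = filter (∁? (spans? l h)) S
    Ls = filter (λ e → hi π e ≤? x) Ns
    Rs = filter (∁? (λ e → hi π e ≤? x)) Ns

    A B : ℕ
    A = cost π Ls
    B = cost π Rs

    cost-split : cost π S ≡ cost π Fs + (A + B)
    cost-split = trans (sum-map-partition width (spans? l h) S)
                       (cong (cost π Fs +_) (sum-map-partition width (λ e → hi π e ≤? x) Ns))

    Ns⊆S : Ns ⊆ S
    Ns⊆S = proj₁ ∘ ∈-filter⁻ (∁? (spans? l h)) {xs = S}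

    Fₙ : NoncrossingForest l h Ns
    Fₙ = restrict (∁? (spans? l h)) F (λ e∈ _ → inside e∈)

    right-of-x : ∀ {e} → e ∈ Ns → ¬ hi π e ≤ x → x ≤ lo π e
    right-of-x e∈ hi≰x with ∈-filter⁻ (∁? (spans? l h)) {xs = S} e∈
    ... | e∈S , not-spans with classify e∈S
    ...   | inj₁ spans           = ⊥-elim (not-spans spans)
    ...   | inj₂ (inj₁ hi≤x)    = ⊥-elim (hi≰x hi≤x)
    ...   | inj₂ (inj₂ x≤lo)    = x≤lo

    left : CostBound (suc a) l x Ls
    left = boundˡ (restrict _ Fₙ λ e∈ hi≤x → proj₁ (inside (Ns⊆S e∈)) , hi≤x)

    right : CostBound (suc b) x h Rs
    right = boundʳ (restrict _ Fₙ λ e∈ hi≰x → right-of-x e∈ hi≰x , proj₂ (inside (Ns⊆S e∈)))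

    Ls⊆S : Ls ⊆ S
    Ls⊆S = Ns⊆S ∘ proj₁ ∘ ∈-filter⁻ (λ e → hi π e ≤? x) {xs = Ns}

    Rs⊆S : Rs ⊆ S
    Rs⊆S = Ns⊆S ∘ proj₁ ∘ ∈-filter⁻ (∁? (λ e → hi π e ≤? x)) {xs = Ns}

    slack-or-detour : (A + suc a ≤ triangular (suc a) ⊎ B + suc b ≤ triangular (suc b)) ⊎ Detour S l h
    slack-or-detour with triangular (suc a) <? A + suc a | triangular (suc b) <? B + suc b
    ... | yes largeˡ | yes largeʳ =
      inj₂ (join (PathIn-mono Ls⊆S (proj₂ left largeˡ)) (PathIn-mono Rs⊆S (proj₂ right largeʳ)))
    ... | no smallˡ | _       = inj₁ (inj₁ (≮⇒≥ smallˡ))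
    ... | yes _  | no smallʳ = inj₁ (inj₂ (≮⇒≥ smallʳ))

    spanning-edge : ∀ {e} → Fs ≡ [ e ] → e ∈ S × Spans l h e
    spanning-edge Fs≡e = ∈-filter⁻ (spans? l h) {xs = S} (subst (_ ∈_) (sym Fs≡e) (here refl))

    bound : CostBound d l h S
    bound with at-most-one-spanning (restrict (spans? l h) F (λ e∈ _ → inside e∈)) (proj₂ ∘ ∈-filter⁻ (spans? l h) {xs = S})
    ... | inj₁ Fs≡[] = subst (_≤ triangular d) (sym cost≡) A+B≤ , path-if-large
      where
      cost≡ : cost π S ≡ A + B
      cost≡ = trans cost-split (cong (λ T → cost π T + (A + B)) Fs≡[])
      A+B≤ : A + B ≤ triangular d
      A+B≤ = triangular-superadditive (suc a) (suc b) (proj₁ left) (proj₁ right)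
      path-if-large : triangular d < cost π S + d → PathIn S l h
      path-if-large large with slack-or-detour
      ... | inj₂ detour = proj₁ detour
      ... | inj₁ slack = ⊥-elim (<⇒≱ large
              (subst (λ c → c + d ≤ triangular d) (sym cost≡) (triangular-glue a b (proj₁ left) (proj₁ right) slack)))
    ... | inj₂ (e , Fs≡e) with spanning-edge Fs≡e | slack-or-detour
    ...   | e∈S , spans | inj₂ detour = ⊥-elim (acyclic (Spans-cycle detour e∈S spans))
    ...   | e∈S , spans | inj₁ slack =
      subst (_≤ triangular d) (sym cost≡) (triangular-glue a b (proj₁ left) (proj₁ right) slack) ,
      λ _ → Spans-path e∈S spans (subst (l <_) l+d≡h (m<m+n l z<s))
      where
      cost≡ : cost π S ≡ A + B + d
      cost≡ = begin
        cost π S              ≡⟨ cost-split ⟩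
        cost π Fs + (A + B)   ≡⟨ cong (λ T → cost π T + (A + B)) Fs≡e ⟩
        width e + 0 + (A + B) ≡⟨ cong (λ w → w + 0 + (A + B)) (Spans-width l+d≡h spans) ⟩
        d + 0 + (A + B)       ≡⟨ cong (_+ (A + B)) (+-identityʳ d) ⟩
        d + (A + B)           ≡⟨ +-comm d (A + B) ⟩
        A + B + d             ∎
        where open ≡-Reasoning

  cost-bound : ∀ d → Acc _<_ d → ∀ {l h S} → l + d ≡ h → NoncrossingForest l h S → CostBound d l h S
  cost-bound zero _ {S = []} _ _ = z≤n , λ ()
  cost-bound zero _ {l} {h} {e ∷ _} l+0≡h F = ⊥-elim (<⇒≱ (lo<hi (oriented (here refl))) (begin
    hi π e   ≤⟨ proj₂ (inside (here refl)) ⟩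
    h        ≡⟨ trans (sym l+0≡h) (+-identityʳ l) ⟩
    l        ≤⟨ proj₁ (inside (here refl)) ⟩
    lo π e   ∎))
    where open NoncrossingForest F
          open ≤-Reasoning
  cost-bound (suc zero) _ {l} l+1≡h F with at-most-one-spanning F (unit-window-spans l+1≡h F)
  ... | inj₁ refl = z≤n , λ { (s≤s ()) }
  ... | inj₂ (e , refl) = ≤-reflexive (cong (_+ 0) (Spans-width l+1≡h spans))
                        , λ _ → Spans-path (here refl) spans (subst (l <_) l+1≡h (m<m+n l z<s))
    where spans : Spans l _ e
          spans = unit-window-spans l+1≡h F (here refl)
  cost-bound (suc (suc d)) (acc rec) {l} {h} {S} l+d≡h F with split F l+1<h
    where l+1<h : suc l < h
          l+1<h = subst (suc l <_) (trans (sym (+-suc l (suc d))) l+d≡h) (s≤s (m<m+n l z<s))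
  ... | x , l<x , x<h , classify with <⇒+suc l<x | <⇒+suc x<h
  ... | a , l+a≡x | b , x+b≡h = subst (λ d → CostBound d l h S) (sym d≡)
        (Glue.bound l+a≡x x+b≡h F classify (cost-bound (suc a) (rec a<d) l+a≡x) (cost-bound (suc b) (rec b<d) x+b≡h))
    where
    d≡ : suc (suc d) ≡ suc a + suc b
    d≡ = +-cancelˡ-≡ l _ _ (trans l+d≡h (sym (offsets-+ l (suc a) l+a≡x x+b≡h)))
    a<d : suc a < suc (suc d)
    a<d = subst (suc a <_) (sym d≡) (m<m+n (suc a) z<s)
    b<d : suc b < suc (suc d)
    b<d = subst (suc b <_) (sym d≡) (m<n+m (suc b) z<s)

planar-forest-cost : ∀ {m} (π : Arrangement (suc m)) {E : Graph (suc m)} →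
                     SimpleGraph E → Planar E π → ¬ HasCycle E → cost π E ≤ suc m C 2
planar-forest-cost {m} π {E} simple planar acyclic =
  subst (cost π E ≤_) (triangular≡C2 m) (proj₁ (cost-bound π m (<-wellFounded m) refl forest))
  where
  pos≤m : ∀ u → pos π u ≤ m
  pos≤m u = ≤-pred (toℕ<n (π ⟨$⟩ʳ u))
  forest : NoncrossingForest π 0 m E
  forest = record
    { simple = simple ; planar = planar ; acyclic = acyclic
    ; inside = λ { {u , v} _ → z≤n , ⊔-lub (pos≤m u) (pos≤m v) } }

star-edge : ∀ {m u v} → (u , v) ∈ star m → u ≡ Fin.zero × ∃ λ i → v ≡ Fin.suc i
star-edge uv∈ with ∈-map⁻ (λ i → (Fin.zero , Fin.suc i)) uv∈
... | i , _ , refl = refl , i , refl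

star-spoke : ∀ {m} (i : Fin m) → (Fin.zero , Fin.suc i) ∈ star m
star-spoke i = ∈-map⁺ (λ i → (Fin.zero , Fin.suc i)) (∈-allFin i)

star-simple : ∀ m → SimpleGraph (star m)
star-simple m = All.tabulate oriented , Unique.map⁺ spoke-injective (Unique.allFin⁺ m)
  where
  oriented : ∀ {e} → e ∈ star m → toℕ (proj₁ e) < toℕ (proj₂ e)
  oriented {_ , _} e∈ with star-edge e∈
  ... | refl , _ , refl = s≤s z≤n
  spoke-injective : ∀ {i j : Fin m} → (Fin.zero {m} , Fin.suc i) ≡ (Fin.zero , Fin.suc j) → i ≡ j
  spoke-injective refl = refl

star-connected : ∀ m → Connected (star m)
star-connected m u v = to-hub u ◅◅ from-hub v
  where
  to-hub : ∀ u → Star (Adj (star m)) u Fin.zero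
  to-hub Fin.zero    = ε
  to-hub (Fin.suc i) = inj₂ (star-spoke i) ◅ ε
  from-hub : ∀ v → Star (Adj (star m)) Fin.zero v
  from-hub Fin.zero    = ε
  from-hub (Fin.suc i) = inj₁ (star-spoke i) ◅ ε

star-adj-hub : ∀ {m u v} → Adj (star m) u v → u ≡ Fin.zero ⊎ v ≡ Fin.zero
star-adj-hub (inj₁ uv∈) = inj₁ (proj₁ (star-edge uv∈))
star-adj-hub (inj₂ vu∈) = inj₂ (proj₁ (star-edge vu∈))

star-walks-backtrack : ∀ {m u w₁ w₂ y} → Adj (star m) u w₁ → Adj (star m) w₁ w₂ → Adj (star m) w₂ y →
                       u ≢ w₂ → w₁ ≢ w₂ → w₁ ≢ y → ⊥
star-walks-backtrack uw₁ w₁w₂ w₂y u≢w₂ w₁≢w₂ w₁≢y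
  with star-adj-hub uw₁ | star-adj-hub w₁w₂ | star-adj-hub w₂y
... | inj₁ refl | inj₂ refl | _         = u≢w₂ refl
... | inj₂ refl | _         | inj₁ refl = w₁≢w₂ refl
... | inj₂ refl | _         | inj₂ refl = w₁≢y refl
... | inj₁ _    | inj₁ refl | inj₁ refl = w₁≢w₂ refl
... | inj₁ _    | inj₁ refl | inj₂ refl = w₁≢y refl

star-acyclic : ∀ m → ¬ HasCycle (star m)
star-acyclic m (_ , _ ∷ [] , s≤s () , _)
star-acyclic m (v , w₁ ∷ w₂ ∷ [] , _ , (v∉ ∷ w₁∉ ∷ _) , vw₁ ∷ w₁w₂ ∷ w₂v ∷ [-]) =
  star-walks-backtrack vw₁ w₁w₂ w₂v (All.lookup v∉ (there (here refl))) (All.head w₁∉) (All.head v∉ ∘ sym)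
star-acyclic m (v , w₁ ∷ w₂ ∷ w₃ ∷ _ , _ , (v∉ ∷ w₁∉ ∷ _) , vw₁ ∷ w₁w₂ ∷ w₂w₃ ∷ _) =
  star-walks-backtrack vw₁ w₁w₂ w₂w₃ (All.lookup v∉ (there (here refl))) (All.head w₁∉) (All.lookup w₁∉ (there (here refl)))

star-tree : ∀ m → IsTree (star m)
star-tree m = star-simple m , star-connected m , star-acyclic m

⊓-or-⊔ : ∀ m n → m ⊓ n ≡ m ⊎ m ⊔ n ≡ m
⊓-or-⊔ m n with ≤-total m n
... | inj₁ m≤n = inj₁ (m≤n⇒m⊓n≡m m≤n)
... | inj₂ n≤m = inj₂ (m≥n⇒m⊔n≡m n≤m)

no-crossing-with-shared-end : ∀ {a b c d z} → a < b → b < c → c < d → a ≡ z ⊎ c ≡ z → b ≡ z ⊎ d ≡ z → ⊥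
no-crossing-with-shared-end a<b _   _   (inj₁ refl) (inj₁ refl) = <-irrefl refl a<b
no-crossing-with-shared-end a<b b<c c<d (inj₁ refl) (inj₂ refl) = <-irrefl refl (<-trans a<b (<-trans b<c c<d))
no-crossing-with-shared-end _   b<c _   (inj₂ refl) (inj₁ refl) = <-irrefl refl b<c
no-crossing-with-shared-end _   _   c<d (inj₂ refl) (inj₂ refl) = <-irrefl refl c<d

star-projective : ∀ m (π : Arrangement (suc m)) → Projective (star m) (hub m) π
star-projective m π = planar , uncovered
  where
  hub-end : ∀ {e} → e ∈ star m → lo π e ≡ pos π (hub m) ⊎ hi π e ≡ pos π (hub m)
  hub-end {_ , v} e∈ with star-edge e∈
  ... | refl , _ = ⊓-or-⊔ (pos π Fin.zero) (pos π v)
  planar : Planar (star m) π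
  planar e f e∈ f∈ (inj₁ (p , q , r)) = no-crossing-with-shared-end p q r (hub-end e∈) (hub-end f∈)
  planar e f e∈ f∈ (inj₂ (p , q , r)) = no-crossing-with-shared-end p q r (hub-end f∈) (hub-end e∈)
  uncovered : RootUncovered (star m) (hub m) π
  uncovered e e∈ (lo<r , r<hi) with hub-end e∈
  ... | inj₁ lo≡r = <-irrefl lo≡r lo<r
  ... | inj₂ hi≡r = <-irrefl (sym hi≡r) r<hi

sum-tabulate-suc : ∀ m (f : Fin m → ℕ) → sum (tabulate (suc ∘ f)) ≡ m + sum (tabulate f)
sum-tabulate-suc zero    f = refl
sum-tabulate-suc (suc m) f = cong suc (begin
  f Fin.zero + sum (tabulate (suc ∘ f ∘ Fin.suc))   ≡⟨ cong (f Fin.zero +_) (sum-tabulate-suc m (f ∘ Fin.suc)) ⟩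
  f Fin.zero + (m + sum (tabulate (f ∘ Fin.suc)))   ≡⟨ x+[y+z]≡y+[x+z] (f Fin.zero) m _ ⟩
  m + (f Fin.zero + sum (tabulate (f ∘ Fin.suc)))   ∎)
  where open ≡-Reasoning

sum-tabulate-toℕ+1 : ∀ m → sum (tabulate {n = m} (suc ∘ toℕ)) ≡ triangular m
sum-tabulate-toℕ+1 zero    = refl
sum-tabulate-toℕ+1 (suc m) = cong suc (trans (sum-tabulate-suc m (suc ∘ toℕ)) (cong (m +_) (sum-tabulate-toℕ+1 m)))

star-cost : ∀ m → cost Permutation.id (star m) ≡ suc m C 2
star-cost m = begin
  cost Permutation.id (star m)               ≡⟨ cong sum (map-∘ (allFin m)) ⟨
  sum (map (suc ∘ toℕ) (allFin m))           ≡⟨ cong sum (map-tabulate {n = m} id (suc ∘ toℕ)) ⟩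
  sum (tabulate {n = m} (suc ∘ toℕ))         ≡⟨ sum-tabulate-toℕ+1 m ⟩
  triangular m                               ≡⟨ triangular≡C2 m ⟩
  suc m C 2                                  ∎
  where open ≡-Reasoning

mainTheorem5 : (m : ℕ) →
    IsTree (star m)
    × IsDprMax (star m) (hub m) (suc m C 2)
    × ((E : Graph (suc m)) (r : Fin (suc m)) (k : ℕ) →
         IsTree E → IsDprMax E r k → k ≤ suc m C 2)
mainTheorem5 m =
  star-tree m ,
  ( (Permutation.id , star-projective m Permutation.id , star-cost m)
  , λ π (planar , _) → planar-forest-cost π (star-simple m) planar (star-acyclic m) ) ,
  λ { E r k (simple , _ , acyclic) ((π , (planar , _) , cost≡k) , _) →
        subst (_≤ suc m C 2) cost≡k (planar-forest-cost π simple planar acyclic) }
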